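{- Let $\mathcal{M}$ be an $r$-graph with $m\geq 2$ edges. Let $\mathcal{G}$ be an $r$-graph on $[n]$ and $\overline{\mathcal{G}}=\binom{[n]}{r}\setminus\mathcal{G}$ its complement. Let $\mathcal{G}_0$ be the set of edges of $\mathcal{G}$ that do not lie in any copy of $\mathcal{M}$ contained in $\mathcal{G}$. Then $|\mathcal{G}_0|\leq(m-1)|\overline{\mathcal{G}}|$.
   Context: An $r$-graph is an $r$-uniform hypergraph; a copy of $\mathcal{M}$ in $\mathcal{G}$ is a subgraph of $\mathcal{G}$ isomorphic to $\mathcal{M}$. -}

module Defs where

open import Data.Nat using (ℕ; zero; suc)
open import Data.Bool using (Bool; true; false; T)
open import Data.Fin using (Fin)
open import Data.Fin.Subset using (Subset; ∣_∣; _∈_; inside; outside)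
open import Data.Fin.Subset.Properties using (_∈?_)
open import Data.Fin.Properties using (any?; _≟_)
open import Data.Vec using (Vec; []; _∷_; tabulate)
open import Data.List using (List; []; _∷_; map; _++_; filter)
open import Data.Product using (Σ; ∃; _×_; _,_)
open import Function.Definitions using (Injective)
open import Relation.Binary.PropositionalEquality using (_≡_)
open import Relation.Nullary using (¬_; Dec; yes; no)
open import Relation.Nullary.Decidable using (⌊_⌋; _×-dec_)
open import Data.Nat using () renaming (_≟_ to _≟ℕ_)
open import Data.Bool using () renaming (_≟_ to _≟𝔹_)

record Graph (r n : ℕ) : Set where
  field
    isEdge  : Subset n → Bool
    uniform : ∀ s → isEdge s ≡ true → ∣ s ∣ ≡ r
open Graph public

allSubsets : (n : ℕ) → List (Subset n)
allSubsets zero    = [] ∷ []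
allSubsets (suc n) = map (outside ∷_) (allSubsets n) ++ map (inside ∷_) (allSubsets n)

edges : ∀ {r n} → Graph r n → List (Subset n)
edges G = filter (λ s → isEdge G s ≟𝔹 true) (allSubsets _)

nonEdges : ∀ {r n} → Graph r n → List (Subset n)
nonEdges {r} G = filter (λ s → (∣ s ∣ ≟ℕ r) ×-dec (isEdge G s ≟𝔹 false)) (allSubsets _)

image : ∀ {k n} → (Fin k → Fin n) → Subset k → Subset n
image φ s = tabulate λ j → ⌊ any? (λ i → (i ∈? s) ×-dec (φ i ≟ j)) ⌋

-- A copy of M in G: an injective vertex map sending every edge of M to an
-- edge of G (the copy is the subgraph consisting of the images of M's edges).
IsCopy : ∀ {r k n} → Graph r k → Graph r n → (Fin k → Fin n) → Set
IsCopy M G φ = Injective _≡_ _≡_ φ × (∀ s → isEdge M s ≡ true → isEdge G (image φ s) ≡ true)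

InCopy : ∀ {r k n} → Graph r k → (Fin k → Fin n) → Subset n → Set
InCopy M φ e = ∃ λ s → isEdge M s ≡ true × image φ s ≡ e

InG₀ : ∀ {r k n} → Graph r k → Graph r n → Subset n → Set
InG₀ M G e = isEdge G e ≡ true × ¬ (∃ λ φ → IsCopy M G φ × InCopy M φ e)

-- Proof by double counting over pairs (v, s), where v : [k] ↪ [n] is an
-- embedding and s an edge of M.  For an r-set e let N(e) (copiesThrough M e
-- below) be the number of such pairs with v(s) = e.
--  * Symmetry: N(e) depends only on |e|.  Relabelling [n] by an involution t
--    permutes the embeddings (v ↦ t ∘ v), so N(t(e)) = N(e); and any two sets
--    of equal size are joined by a chain of transpositions.  Hence N(e) = K
--    for every r-set e, and K ≥ 1 because k ≤ n gives at least one embedding.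
--  * Local bound: for a fixed embedding v, the number of edges s of M with
--    v(s) ∈ G₀ is at most (m - 1) times the number with v(s) ∉ G.  Either v
--    is a copy of M in G (then no v(s) is in G₀), or some v(s₀) is a
--    non-edge (then s₀ contributes to the right side and not to the left).
-- Summing the local bound over all v gives |G₀|·K ≤ (m - 1)·|Ḡ|·K.
module Submission where

open import Defs
open import Data.Nat using (ℕ; zero; suc; _+_; _*_; _∸_; _≤_; _<_; z≤n; s≤s; >-nonZero)
open import Data.Nat.Properties
open import Data.Nat.ListAction using (sum)
open import Data.Nat.Tactic.RingSolver using (solve-∀)
open import Data.Nat.ListAction.Properties using (sum-↭)
open import Data.Bool using (Bool; true; false)
open import Data.Bool.Properties using (¬-not; T-≡)
import Data.Bool as Bool
open import Data.Fin using (Fin; zero; suc; inject≤)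
import Data.Fin.Properties as Fin
open import Data.Fin.Subset using (Subset; ∣_∣)
open import Data.Fin.Subset.Properties using (∣p∣≤n)
open import Data.Vec using (Vec; []; _∷_; tabulate; lookup)
import Data.Vec as Vec
open import Data.Vec.Relation.Binary.Pointwise.Extensional using (ext; Pointwise-≡⇒≡)
open import Data.Vec.Properties using (lookup∘tabulate; lookup-map; ∷-injective; ≡-dec; []=⇒lookup; lookup⇒[]=; lookup∘update; lookup∘update′)
open import Data.List using (List; []; _∷_; length; map; filter; allFin; cartesianProductWith)
open import Data.List.Properties using (length-map; map-∘)
open import Data.List.Membership.Propositional using (_∈_; find; lose)
open import Data.List.Membership.Propositional.Properties using (∈-map⁺; ∈-map⁻; ∈-++⁺ˡ; ∈-++⁺ʳ; ∈-filter⁺; ∈-filter⁻; ∈-allFin; ∈-cartesianProductWith⁺)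
open import Data.List.Membership.Propositional.Properties.WithK using (unique∧set⇒bag)
open import Data.List.Relation.Unary.Any using (here; there; any?)
open import Data.List.Relation.Unary.All using (All; []; _∷_) renaming (map to All-map; lookup to All-lookup; tabulate to All-tabulate)
open import Data.List.Relation.Unary.All.Properties using () renaming (map⁺ to All-map⁺)
open import Data.List.Relation.Unary.Unique.Propositional using (Unique; []; _∷_)
import Data.List.Relation.Unary.Unique.Propositional.Properties as Unique
open import Data.List.Relation.Binary.Permutation.Propositional using (_↭_; ↭-sym)
open import Data.List.Relation.Binary.Permutation.Propositional.Properties using (↭-length) renaming (map⁺ to ↭-map⁺)
open import Data.List.Relation.Binary.BagAndSetEquality using (∼bag⇒↭)
open import Data.Product using (∃; _×_; _,_; proj₁; proj₂)
open import Function using (_∘_)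
open import Function.Bundles using (mk⇔; Equivalence)
open import Function.Definitions using (Injective)
open import Relation.Binary.PropositionalEquality
open import Relation.Nullary using (Dec; yes; no; contradiction)
open import Relation.Nullary.Decidable using (_×-dec_; _→-dec_; map′; toWitness; fromWitness)
open import Level using (Level)

private
  variable
    a b : Level
    A : Set a
    B : Set b

∑ : List A → (A → ℕ) → ℕ
∑ xs f = sum (map f xs)

∑-cong : (xs : List A) {f g : A → ℕ} → (∀ {x} → x ∈ xs → f x ≡ g x) → ∑ xs f ≡ ∑ xs g
∑-cong []       f≡g = refl
∑-cong (x ∷ xs) f≡g = cong₂ _+_ (f≡g (here refl)) (∑-cong xs (f≡g ∘ there))

∑-mono : (xs : List A) {f g : A → ℕ} → (∀ {x} → x ∈ xs → f x ≤ g x) → ∑ xs f ≤ ∑ xs g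
∑-mono []       f≤g = z≤n
∑-mono (x ∷ xs) f≤g = +-mono-≤ (f≤g (here refl)) (∑-mono xs (f≤g ∘ there))

∑-zero : {xs : List A} (f : A → ℕ) → All (λ x → f x ≡ 0) xs → ∑ xs f ≡ 0
∑-zero f []           = refl
∑-zero f (fx≡0 ∷ f≡0) = cong₂ _+_ fx≡0 (∑-zero f f≡0)

∑-const : (xs : List A) (c : ℕ) → ∑ xs (λ _ → c) ≡ length xs * c
∑-const []       c = refl
∑-const (x ∷ xs) c = cong (c +_) (∑-const xs c)

∑-*ˡ : (xs : List A) (c : ℕ) (f : A → ℕ) → ∑ xs (λ x → c * f x) ≡ c * ∑ xs f
∑-*ˡ []       c f = sym (*-zeroʳ c)
∑-*ˡ (x ∷ xs) c f = trans (cong (c * f x +_) (∑-*ˡ xs c f)) (sym (*-distribˡ-+ c (f x) (∑ xs f)))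

∑-+ : (xs : List A) (f g : A → ℕ) → ∑ xs (λ x → f x + g x) ≡ ∑ xs f + ∑ xs g
∑-+ []       f g = refl
∑-+ (x ∷ xs) f g = trans (cong (f x + g x +_) (∑-+ xs f g)) (+-assoc-swap (f x) (g x) (∑ xs f) (∑ xs g))
  where
  +-assoc-swap : ∀ p q u w → p + q + (u + w) ≡ p + u + (q + w)
  +-assoc-swap = solve-∀

∑-swap : (xs : List A) (ys : List B) (f : A → B → ℕ) →
         ∑ xs (λ x → ∑ ys (f x)) ≡ ∑ ys (λ y → ∑ xs (λ x → f x y))
∑-swap []       ys f = sym (trans (∑-const ys 0) (*-zeroʳ (length ys)))
∑-swap (x ∷ xs) ys f = trans (cong (∑ ys (f x) +_) (∑-swap xs ys f))
                             (sym (∑-+ ys (f x) (λ y → ∑ xs (λ x → f x y))))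

∑-map : (g : A → B) (xs : List A) (f : B → ℕ) → ∑ (map g xs) f ≡ ∑ xs (f ∘ g)
∑-map g xs f = cong sum (sym (map-∘ xs))

∑-↭ : {xs ys : List A} (f : A → ℕ) → xs ↭ ys → ∑ xs f ≡ ∑ ys f
∑-↭ f xs↭ys = sum-↭ (↭-map⁺ f xs↭ys)

∑-member : {xs : List A} (f : A → ℕ) {x : A} → x ∈ xs → f x ≤ ∑ xs f
∑-member {xs = y ∷ ys} f (here refl) = m≤m+n (f y) (∑ ys f)
∑-member {xs = y ∷ ys} f (there x∈) = ≤-trans (∑-member f x∈) (m≤n+m (∑ ys f) (f y))

∑-≤1-with-zero : {xs : List A} (f : A → ℕ) → (∀ x → f x ≤ 1) →
                 ∀ {x} → x ∈ xs → f x ≡ 0 → ∑ xs f ≤ length xs ∸ 1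
∑-≤1-with-zero {xs = y ∷ ys} f f≤1 (here refl) fy≡0 rewrite fy≡0 = ∑-≤-length ys
  where
  ∑-≤-length : ∀ zs → ∑ zs f ≤ length zs
  ∑-≤-length []       = z≤n
  ∑-≤-length (z ∷ zs) = +-mono-≤ (f≤1 z) (∑-≤-length zs)
∑-≤1-with-zero {xs = y ∷ ys@(_ ∷ _)} f f≤1 (there x∈) fx≡0 =
  +-mono-≤ (f≤1 y) (∑-≤1-with-zero f f≤1 x∈ fx≡0)

first-member : {xs : List A} → 1 ≤ length xs → ∃ λ x → x ∈ xs
first-member {xs = x ∷ _} _ = x , here refl

unique-same-members⇒↭ : {xs ys : List A} → Unique xs → Unique ys →
                         (∀ {x} → x ∈ xs → x ∈ ys) → (∀ {x} → x ∈ ys → x ∈ xs) → xs ↭ ys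
unique-same-members⇒↭ ux uy xs⊆ys ys⊆xs = ∼bag⇒↭ (unique∧set⇒bag ux uy (mk⇔ xs⊆ys ys⊆xs))

_≟ₛ_ : ∀ {n} (p q : Subset n) → Dec (p ≡ q)
_≟ₛ_ = ≡-dec Bool._≟_

δ : ∀ {n} → Subset n → Subset n → ℕ
δ p q with p ≟ₛ q
... | yes _ = 1
... | no  _ = 0

δ-refl : ∀ {n} (p : Subset n) → δ p p ≡ 1
δ-refl p with p ≟ₛ p
... | yes _   = refl
... | no  p≢p = contradiction refl p≢p

δ-≢ : ∀ {n} {p q : Subset n} → p ≢ q → δ p q ≡ 0
δ-≢ {p = p} {q} p≢q with p ≟ₛ q
... | yes p≡q = contradiction p≡q p≢q
... | no  _   = refl

δ-injective : ∀ {n} {f : Subset n → Subset n} → (∀ {p q} → f p ≡ f q → p ≡ q) →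
              ∀ p q → δ (f p) (f q) ≡ δ p q
δ-injective {f = f} f-inj p q with f p ≟ₛ f q | p ≟ₛ q
... | yes _   | yes _   = refl
... | no  _   | no  _   = refl
... | yes fp≡fq | no p≢q = contradiction (f-inj fp≡fq) p≢q
... | no fp≢fq  | yes refl = contradiction refl fp≢fq

∑-δ-unique : ∀ {n} {xs : List (Subset n)} → Unique xs → ∀ p → ∑ xs (δ p) ≤ 1
∑-δ-unique []                         p = z≤n
∑-δ-unique {xs = y ∷ ys} (y∉ys ∷ uys) p = by-cases (p ≟ₛ y)
  where
  by-cases : Dec (p ≡ y) → δ p y + ∑ ys (δ p) ≤ 1
  by-cases (yes refl) = ≤-reflexive (cong₂ _+_ (δ-refl p) (∑-zero (δ p) (All-map δ-≢ y∉ys)))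
  by-cases (no  p≢y)  = ≤-trans (≤-reflexive (cong (_+ ∑ ys (δ p)) (δ-≢ p≢y))) (∑-δ-unique uys p)

vec-ext : ∀ {n} {u w : Vec A n} → (∀ i → lookup u i ≡ lookup w i) → u ≡ w
vec-ext u≗w = Pointwise-≡⇒≡ (ext u≗w)

bool-ext : ∀ {x y : Bool} → (x ≡ true → y ≡ true) → (y ≡ true → x ≡ true) → x ≡ y
bool-ext {false} {false} _ _ = refl
bool-ext {false} {true}  _ y⇒x = y⇒x refl
bool-ext {true}  {false} x⇒y _ = sym (x⇒y refl)
bool-ext {true}  {true}  _ _ = refl

image⁻ : ∀ {k n} (φ : Fin k → Fin n) s j → lookup (image φ s) j ≡ true →
         ∃ λ i → lookup s i ≡ true × φ i ≡ j
image⁻ φ s j j∈φs =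
  let i , i∈s , φi≡j = toWitness (Equivalence.from T-≡ (trans (sym (lookup∘tabulate _ j)) j∈φs))
  in  i , []=⇒lookup i∈s , φi≡j

image⁺ : ∀ {k n} (φ : Fin k → Fin n) s i → lookup s i ≡ true → lookup (image φ s) (φ i) ≡ true
image⁺ φ s i i∈s = trans (lookup∘tabulate _ (φ i))
  (Equivalence.to T-≡ (fromWitness (i , lookup⇒[]= i s i∈s , refl)))

elements : ∀ {n} → Subset n → List (Fin n)
elements []          = []
elements (true  ∷ p) = zero ∷ map suc (elements p)
elements (false ∷ p) = map suc (elements p)

length-elements : ∀ {n} (p : Subset n) → length (elements p) ≡ ∣ p ∣
length-elements []          = refl
length-elements (true  ∷ p) = cong suc (trans (length-map suc (elements p)) (length-elements p))
length-elements (false ∷ p) = trans (length-map suc (elements p)) (length-elements p)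

∈-elements⁻ : ∀ {n} (p : Subset n) {i} → i ∈ elements p → lookup p i ≡ true
∈-elements⁻ (true ∷ p) (here refl) = refl
∈-elements⁻ (true ∷ p) (there i∈) with ∈-map⁻ suc i∈
... | _ , j∈ , refl = ∈-elements⁻ p j∈
∈-elements⁻ (false ∷ p) i∈ with ∈-map⁻ suc i∈
... | _ , j∈ , refl = ∈-elements⁻ p j∈

∈-elements⁺ : ∀ {n} (p : Subset n) i → lookup p i ≡ true → i ∈ elements p
∈-elements⁺ (true  ∷ p) zero    _   = here refl
∈-elements⁺ (true  ∷ p) (suc i) i∈p = there (∈-map⁺ suc (∈-elements⁺ p i i∈p))
∈-elements⁺ (false ∷ p) (suc i) i∈p = ∈-map⁺ suc (∈-elements⁺ p i i∈p)

unique-elements : ∀ {n} (p : Subset n) → Unique (elements p)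
unique-elements []          = []
unique-elements (true  ∷ p) = All-map⁺ (All-tabulate (λ _ ())) ∷ Unique.map⁺ Fin.suc-injective (unique-elements p)
unique-elements (false ∷ p) = Unique.map⁺ Fin.suc-injective (unique-elements p)

-- An injective map preserves the size of subsets: its image of s lists
-- exactly the images of the elements of s.
∣image∣ : ∀ {k n} (φ : Fin k → Fin n) → Injective _≡_ _≡_ φ → ∀ s → ∣ image φ s ∣ ≡ ∣ s ∣
∣image∣ φ φ-inj s = begin
  ∣ image φ s ∣                ≡⟨ length-elements (image φ s) ⟨
  length (elements (image φ s)) ≡⟨ ↭-length elements-φs↭φ-elements ⟩
  length (map φ (elements s))   ≡⟨ length-map φ (elements s) ⟩
  length (elements s)           ≡⟨ length-elements s ⟩
  ∣ s ∣                         ∎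
  where
  open ≡-Reasoning
  elements-φs↭φ-elements : elements (image φ s) ↭ map φ (elements s)
  elements-φs↭φ-elements = unique-same-members⇒↭
    (unique-elements (image φ s)) (Unique.map⁺ φ-inj (unique-elements s))
    (λ j∈ → let i , i∈s , φi≡j = image⁻ φ s _ (∈-elements⁻ (image φ s) j∈)
            in subst (_∈ map φ (elements s)) φi≡j (∈-map⁺ φ (∈-elements⁺ s i i∈s)))
    (λ j∈ → let i , i∈ , j≡φi = ∈-map⁻ φ j∈
            in subst (_∈ elements (image φ s)) (sym j≡φi)
                 (∈-elements⁺ (image φ s) (φ i) (image⁺ φ s i (∈-elements⁻ s i∈))))

Involution : ∀ {n} → (Fin n → Fin n) → Set
Involution t = ∀ j → t (t j) ≡ j

-- relabel t e = t⁻¹(e), which is t(e) when t is an involution.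
relabel : ∀ {n} → (Fin n → Fin n) → Subset n → Subset n
relabel t e = tabulate (λ j → lookup e (t j))

lookup-relabel : ∀ {n} (t : Fin n → Fin n) e j → lookup (relabel t e) j ≡ lookup e (t j)
lookup-relabel t e = lookup∘tabulate (λ j → lookup e (t j))

relabel-involutive : ∀ {n} {t : Fin n → Fin n} → Involution t → ∀ e → relabel t (relabel t e) ≡ e
relabel-involutive {t = t} t² e = vec-ext λ j → begin
  lookup (relabel t (relabel t e)) j ≡⟨ lookup-relabel t (relabel t e) j ⟩
  lookup (relabel t e) (t j)          ≡⟨ lookup-relabel t e (t j) ⟩
  lookup e (t (t j))                  ≡⟨ cong (lookup e) (t² j) ⟩
  lookup e j                          ∎
  where open ≡-Reasoning

relabel-injective : ∀ {n} {t : Fin n → Fin n} → Involution t → ∀ {p q} → relabel t p ≡ relabel t q → p ≡ q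
relabel-injective {t = t} t² {p} {q} eq =
  trans (sym (relabel-involutive t² p)) (trans (cong (relabel t) eq) (relabel-involutive t² q))

image-relabel : ∀ {k n} (φ ψ : Fin k → Fin n) {t : Fin n → Fin n} → Involution t →
                (∀ i → ψ i ≡ t (φ i)) → ∀ s → image ψ s ≡ relabel t (image φ s)
image-relabel φ ψ {t} t² ψ≗tφ s = vec-ext λ j → bool-ext (ψs⇒tφs j) (tφs⇒ψs j)
  where
  ψs⇒tφs : ∀ j → lookup (image ψ s) j ≡ true → lookup (relabel t (image φ s)) j ≡ true
  ψs⇒tφs j j∈ψs with image⁻ ψ s j j∈ψs
  ... | i , i∈s , refl = trans (lookup-relabel t (image φ s) (ψ i))
    (subst (λ x → lookup (image φ s) x ≡ true) (trans (sym (t² (φ i))) (cong t (sym (ψ≗tφ i))))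
           (image⁺ φ s i i∈s))
  tφs⇒ψs : ∀ j → lookup (relabel t (image φ s)) j ≡ true → lookup (image ψ s) j ≡ true
  tφs⇒ψs j tj∈φs with image⁻ φ s (t j) (trans (sym (lookup-relabel t (image φ s) j)) tj∈φs)
  ... | i , i∈s , φi≡tj = subst (λ x → lookup (image ψ s) x ≡ true)
    (trans (ψ≗tφ i) (trans (cong t φi≡tj) (t² j))) (image⁺ ψ s i i∈s)

RelabelInvariant : ∀ {n} → (Subset n → A) → Set _
RelabelInvariant f = ∀ t → Involution t → ∀ e → f (relabel t e) ≡ f e

lift : ∀ {n} → (Fin n → Fin n) → Fin (suc n) → Fin (suc n)
lift t zero    = zero
lift t (suc i) = suc (t i)

lift-involution : ∀ {n} {t : Fin n → Fin n} → Involution t → Involution (lift t)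
lift-involution t² zero    = refl
lift-involution t² (suc i) = cong suc (t² i)

-- Fixing the first coordinate of an invariant function keeps it invariant,
-- since relabel (lift t) (x ∷ e) reduces to x ∷ relabel t e.
fix-head : ∀ {n} (f : Subset (suc n) → A) → RelabelInvariant f → ∀ x → RelabelInvariant (f ∘ (x ∷_))
fix-head f f-inv x t t² e = f-inv (lift t) (lift-involution t²) (x ∷ e)

swap₀ : ∀ {n} → Fin n → Fin (suc n) → Fin (suc n)
swap₀ j zero    = suc j
swap₀ j (suc i) with i Fin.≟ j
... | yes _ = zero
... | no  _ = suc i

swap₀-hit : ∀ {n} (j : Fin n) → swap₀ j (suc j) ≡ zero
swap₀-hit j with j Fin.≟ j
... | yes _   = refl
... | no  j≢j = contradiction refl j≢j

swap₀-miss : ∀ {n} {i j : Fin n} → i ≢ j → swap₀ j (suc i) ≡ suc i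
swap₀-miss {i = i} {j} i≢j with i Fin.≟ j
... | yes i≡j = contradiction i≡j i≢j
... | no  _   = refl

swap₀-involution : ∀ {n} (j : Fin n) → Involution (swap₀ j)
swap₀-involution j zero    = swap₀-hit j
swap₀-involution j (suc i) with i Fin.≟ j
... | yes refl = refl
... | no  i≢j  = swap₀-miss i≢j

swap₀-relabel : ∀ {n} (e : Subset n) j → lookup e j ≡ false →
                relabel (swap₀ j) (true ∷ e) ≡ false ∷ (e Vec.[ j ]≔ true)
swap₀-relabel e j j∉e = vec-ext pointwise
  where
  pointwise : ∀ i → lookup (relabel (swap₀ j) (true ∷ e)) i ≡ lookup (false ∷ (e Vec.[ j ]≔ true)) i
  pointwise zero = trans (lookup-relabel (swap₀ j) (true ∷ e) zero) j∉e
  pointwise (suc i) with i Fin.≟ j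
  ... | yes refl = trans (lookup-relabel (swap₀ j) (true ∷ e) (suc i))
                     (trans (cong (lookup (true ∷ e)) (swap₀-hit i)) (sym (lookup∘update i e true)))
  ... | no  i≢j  = trans (lookup-relabel (swap₀ j) (true ∷ e) (suc i))
                     (trans (cong (lookup (true ∷ e)) (swap₀-miss i≢j)) (sym (lookup∘update′ i≢j e true)))

∣insert∣ : ∀ {n} (e : Subset n) j → lookup e j ≡ false → ∣ e Vec.[ j ]≔ true ∣ ≡ suc ∣ e ∣
∣insert∣ (false ∷ e) zero    _   = refl
∣insert∣ (true  ∷ e) (suc j) j∉e = cong suc (∣insert∣ e j j∉e)
∣insert∣ (false ∷ e) (suc j) j∉e = ∣insert∣ e j j∉e

missing : ∀ {n} (e : Subset n) → ∣ e ∣ < n → ∃ λ j → lookup e j ≡ false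
missing (false ∷ e) _         = zero , refl
missing (true  ∷ e) (s≤s ∣e∣<n) = let j , j∉e = missing e ∣e∣<n in suc j , j∉e

mutual
  -- Subsets of equal size are joined by a chain of transpositions, so an
  -- invariant function takes the same value on them.
  size-determined : ∀ {n} (f : Subset n → A) → RelabelInvariant f →
                    ∀ e e' → ∣ e ∣ ≡ ∣ e' ∣ → f e ≡ f e'
  size-determined f f-inv []          []           _  = refl
  size-determined f f-inv (true  ∷ e) (true  ∷ e') eq =
    size-determined (f ∘ (true ∷_)) (fix-head f f-inv true) e e' (suc-injective eq)
  size-determined f f-inv (false ∷ e) (false ∷ e') eq =
    size-determined (f ∘ (false ∷_)) (fix-head f f-inv false) e e' eq
  size-determined f f-inv (true  ∷ e) (false ∷ e') eq = move-first f f-inv e e' eq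
  size-determined f f-inv (false ∷ e) (true  ∷ e') eq = sym (move-first f f-inv e' e (sym eq))

  -- The case where 0 lies in the first set only: transpose 0 with a missing j.
  move-first : ∀ {n} (f : Subset (suc n) → A) → RelabelInvariant f →
               ∀ e e' → suc ∣ e ∣ ≡ ∣ e' ∣ → f (true ∷ e) ≡ f (false ∷ e')
  move-first f f-inv e e' eq with missing e (≤-trans (≤-reflexive eq) (∣p∣≤n e'))
  ... | j , j∉e = begin
    f (true ∷ e)                       ≡⟨ f-inv (swap₀ j) (swap₀-involution j) (true ∷ e) ⟨
    f (relabel (swap₀ j) (true ∷ e))   ≡⟨ cong f (swap₀-relabel e j j∉e) ⟩
    f (false ∷ (e Vec.[ j ]≔ true))    ≡⟨ size-determined (f ∘ (false ∷_)) (fix-head f f-inv false)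
                                            _ e' (trans (∣insert∣ e j j∉e) eq) ⟩
    f (false ∷ e')                     ∎
    where open ≡-Reasoning

vectors : ∀ {n} k → List (Vec (Fin n) k)
vectors     zero    = [] ∷ []
vectors {n} (suc k) = cartesianProductWith _∷_ (allFin n) (vectors k)

unique-vectors : ∀ {n} k → Unique (vectors {n} k)
unique-vectors     zero    = [] ∷ []
unique-vectors {n} (suc k) = Unique.cartesianProductWith⁺ _∷_ ∷-injective (Unique.allFin⁺ n) (unique-vectors k)

∈-vectors : ∀ {n k} (v : Vec (Fin n) k) → v ∈ vectors k
∈-vectors []      = here refl
∈-vectors (x ∷ v) = ∈-cartesianProductWith⁺ _∷_ (∈-allFin x) (∈-vectors v)

-- A vector v represents an embedding [k] ↪ [n] when lookup v is injective.
IsEmbedding : ∀ {n k} → Vec (Fin n) k → Set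
IsEmbedding v = Injective _≡_ _≡_ (lookup v)

isEmbedding? : ∀ {n k} (v : Vec (Fin n) k) → Dec (IsEmbedding v)
isEmbedding? v = map′ (λ inj {x} {y} → inj x y) (λ inj x y → inj {x} {y})
  (Fin.all? λ x → Fin.all? λ y → (lookup v x Fin.≟ lookup v y) →-dec (x Fin.≟ y))

embeddings : ∀ n k → List (Vec (Fin n) k)
embeddings n k = filter isEmbedding? (vectors k)

unique-embeddings : ∀ n k → Unique (embeddings n k)
unique-embeddings n k = Unique.filter⁺ isEmbedding? (unique-vectors k)

∈-embeddings⁺ : ∀ {n k} {v : Vec (Fin n) k} → IsEmbedding v → v ∈ embeddings n k
∈-embeddings⁺ {v = v} v-emb = ∈-filter⁺ isEmbedding? (∈-vectors v) v-emb

∈-embeddings⁻ : ∀ {n k} {v : Vec (Fin n) k} → v ∈ embeddings n k → IsEmbedding v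
∈-embeddings⁻ {k = k} v∈ = proj₂ (∈-filter⁻ isEmbedding? {xs = vectors k} v∈)

module _ {n : ℕ} (t : Fin n → Fin n) (t² : Involution t) where

  map-involutive : ∀ {k} (v : Vec (Fin n) k) → Vec.map t (Vec.map t v) ≡ v
  map-involutive v = vec-ext λ i → begin
    lookup (Vec.map t (Vec.map t v)) i ≡⟨ lookup-map i t (Vec.map t v) ⟩
    t (lookup (Vec.map t v) i)         ≡⟨ cong t (lookup-map i t v) ⟩
    t (t (lookup v i))                 ≡⟨ t² (lookup v i) ⟩
    lookup v i                         ∎
    where open ≡-Reasoning

  map-embedding : ∀ {k} {v : Vec (Fin n) k} → IsEmbedding v → IsEmbedding (Vec.map t v)
  map-embedding {v = v} v-emb {x} {y} eq = v-emb (begin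
    lookup v x               ≡⟨ t² (lookup v x) ⟨
    t (t (lookup v x))       ≡⟨ cong t (lookup-map x t v) ⟨
    t (lookup (Vec.map t v) x) ≡⟨ cong t eq ⟩
    t (lookup (Vec.map t v) y) ≡⟨ cong t (lookup-map y t v) ⟩
    t (t (lookup v y))       ≡⟨ t² (lookup v y) ⟩
    lookup v y               ∎)
    where open ≡-Reasoning

  relabel-embeddings : ∀ {k} → map (Vec.map t) (embeddings n k) ↭ embeddings n k
  relabel-embeddings {k} = unique-same-members⇒↭
    (Unique.map⁺ map-injective (unique-embeddings n k)) (unique-embeddings n k)
    (λ w∈ → let v , v∈ , w≡tv = ∈-map⁻ (Vec.map t) w∈
            in subst (_∈ embeddings n k) (sym w≡tv) (∈-embeddings⁺ (map-embedding {v = v} (∈-embeddings⁻ v∈))))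
    (λ {w} w∈ → subst (_∈ map (Vec.map t) (embeddings n k)) (map-involutive w)
                  (∈-map⁺ (Vec.map t) (∈-embeddings⁺ (map-embedding {v = w} (∈-embeddings⁻ w∈)))))
    where
    map-injective : ∀ {u w : Vec (Fin n) k} → Vec.map t u ≡ Vec.map t w → u ≡ w
    map-injective {u} {w} eq = trans (sym (map-involutive u)) (trans (cong (Vec.map t) eq) (map-involutive w))

∈-allSubsets : ∀ {n} (s : Subset n) → s ∈ allSubsets n
∈-allSubsets []          = here refl
∈-allSubsets (false ∷ s) = ∈-++⁺ˡ (∈-map⁺ (false ∷_) (∈-allSubsets s))
∈-allSubsets {suc n} (true ∷ s) = ∈-++⁺ʳ (map (false ∷_) (allSubsets n)) (∈-map⁺ (true ∷_) (∈-allSubsets s))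

module _ {r n : ℕ} (G : Graph r n) where

  ∈-edges⁺ : ∀ {s} → isEdge G s ≡ true → s ∈ edges G
  ∈-edges⁺ {s} = ∈-filter⁺ (λ s → isEdge G s Bool.≟ true) (∈-allSubsets s)

  ∈-edges⁻ : ∀ {s} → s ∈ edges G → isEdge G s ≡ true
  ∈-edges⁻ s∈ = proj₂ (∈-filter⁻ (λ s → isEdge G s Bool.≟ true) {xs = allSubsets n} s∈)

  ∈-nonEdges⁺ : ∀ {s} → ∣ s ∣ ≡ r → isEdge G s ≡ false → s ∈ nonEdges G
  ∈-nonEdges⁺ {s} ∣s∣≡r s∉G =
    ∈-filter⁺ (λ s → (∣ s ∣ ≟ r) ×-dec (isEdge G s Bool.≟ false)) (∈-allSubsets s) (∣s∣≡r , s∉G)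

  ∈-nonEdges⁻ : ∀ {s} → s ∈ nonEdges G → ∣ s ∣ ≡ r × isEdge G s ≡ false
  ∈-nonEdges⁻ s∈ = proj₂ (∈-filter⁻ (λ s → (∣ s ∣ ≟ r) ×-dec (isEdge G s Bool.≟ false)) {xs = allSubsets n} s∈)

landing : ∀ {r k n} → Graph r k → List (Subset n) → Vec (Fin n) k → ℕ
landing M xs v = ∑ (edges M) λ s → ∑ xs (δ (image (lookup v) s))

copiesThrough : ∀ {r k n} → Graph r k → Subset n → ℕ
copiesThrough {k = k} {n} M e = ∑ (embeddings n k) λ v → ∑ (edges M) λ s → δ (image (lookup v) s) e

∑-copiesThrough : ∀ {r k n} (M : Graph r k) (xs : List (Subset n)) →
                  ∑ xs (copiesThrough M) ≡ ∑ (embeddings n k) (landing M xs)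
∑-copiesThrough {k = k} {n} M xs =
  trans (∑-swap xs (embeddings n k) λ e v → ∑ (edges M) λ s → δ (image (lookup v) s) e)
        (∑-cong (embeddings n k) λ {v} _ → ∑-swap xs (edges M) λ e s → δ (image (lookup v) s) e)

-- Relabelling [n] by an involution t permutes the embeddings (v ↦ t ∘ v) and
-- moves every set v(s) to t(v(s)), so the number of copies through t(e)
-- equals the number through e.
copiesThrough-invariant : ∀ {r k n} (M : Graph r k) → RelabelInvariant (copiesThrough {n = n} M)
copiesThrough-invariant {k = k} {n} M t t² e = begin
  ∑ Emb (λ v → ∑ (edges M) λ s → δ (image (lookup v) s) (relabel t e))
    ≡⟨ ∑-↭ _ (↭-sym (relabel-embeddings t t² {k})) ⟩
  ∑ (map (Vec.map t) Emb) (λ v → ∑ (edges M) λ s → δ (image (lookup v) s) (relabel t e))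
    ≡⟨ ∑-map (Vec.map t) Emb _ ⟩
  ∑ Emb (λ v → ∑ (edges M) λ s → δ (image (lookup (Vec.map t v)) s) (relabel t e))
    ≡⟨ ∑-cong Emb (λ {v} _ → ∑-cong (edges M) λ {s} _ → moved v s) ⟩
  ∑ Emb (λ v → ∑ (edges M) λ s → δ (image (lookup v) s) e)
    ∎
  where
  open ≡-Reasoning
  Emb = embeddings n k
  moved : ∀ v s → δ (image (lookup (Vec.map t v)) s) (relabel t e) ≡ δ (image (lookup v) s) e
  moved v s = trans
    (cong (λ p → δ p (relabel t e)) (image-relabel (lookup v) (lookup (Vec.map t v)) t² (λ i → lookup-map i t v) s))
    (δ-injective (relabel-injective t²) (image (lookup v) s) e)

∑-copiesThrough-r-sets : ∀ {r k n} (M : Graph r k) {e₀ : Subset n} → ∣ e₀ ∣ ≡ r →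
                         (xs : List (Subset n)) → (∀ {e} → e ∈ xs → ∣ e ∣ ≡ r) →
                         ∑ xs (copiesThrough M) ≡ length xs * copiesThrough M e₀
∑-copiesThrough-r-sets M {e₀} ∣e₀∣≡r xs xs-r-sets =
  trans (∑-cong xs λ {e} e∈ → size-determined (copiesThrough M) (copiesThrough-invariant M) e e₀
                                (trans (xs-r-sets e∈) (sym ∣e₀∣≡r)))
        (∑-const xs (copiesThrough M e₀))

-- If k ≤ n and M has an edge s, some r-set is passed through by a copy: the
-- image of s under the inclusion [k] ⊆ [n].
r-set-with-copy : ∀ {r k n} (M : Graph r k) → k ≤ n → 1 ≤ length (edges M) →
                  ∃ λ (e₀ : Subset n) → ∣ e₀ ∣ ≡ r × 1 ≤ copiesThrough M e₀
r-set-with-copy {r} {k} {n} M k≤n 1≤m = image (lookup ι) s , ∣e₀∣≡r , 1≤copies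
  where
  s : Subset k
  s = proj₁ (first-member {xs = edges M} 1≤m)
  s∈M : s ∈ edges M
  s∈M = proj₂ (first-member {xs = edges M} 1≤m)
  ι : Vec (Fin n) k
  ι = tabulate (λ i → inject≤ i k≤n)
  ι-embedding : IsEmbedding ι
  ι-embedding {x} {y} eq = Fin.inject≤-injective k≤n k≤n x y
    (trans (sym (lookup∘tabulate _ x)) (trans eq (lookup∘tabulate _ y)))
  ∣e₀∣≡r : ∣ image (lookup ι) s ∣ ≡ r
  ∣e₀∣≡r = trans (∣image∣ (lookup ι) ι-embedding s) (uniform M s (∈-edges⁻ M s∈M))
  1≤copies : 1 ≤ copiesThrough M (image (lookup ι) s)
  1≤copies = ≤-trans (≤-reflexive (sym (δ-refl (image (lookup ι) s))))
    (≤-trans (∑-member (λ s' → δ (image (lookup ι) s') (image (lookup ι) s)) s∈M)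
             (∑-member (λ v → ∑ (edges M) λ s' → δ (image (lookup v) s') (image (lookup ι) s))
                       (∈-embeddings⁺ {v = ι} ι-embedding)))

-- For a fixed embedding v, the edges of M sent into G₀ number at most m - 1
-- times the edges sent outside G: if v is a copy of M in G, no edge goes to
-- G₀; otherwise some edge s₀ goes to a non-edge, which counts on the right
-- and not on the left, while every other edge hits L at most once.
local-bound : ∀ {r k n} (M : Graph r k) (G : Graph r n) {L : List (Subset n)} →
              Unique L → All (InG₀ M G) L → ∀ v → IsEmbedding v →
              landing M L v ≤ (length (edges M) ∸ 1) * landing M (nonEdges G) v
local-bound M G {L} uL L⊆G₀ v v-emb
  with any? (λ s → isEdge G (image (lookup v) s) Bool.≟ false) (edges M)
... | yes some-edge-leaves-G = begin
  landing M L v                                    ≤⟨ ∑-≤1-with-zero _ (λ s → ∑-δ-unique uL _) s₀∈M s₀-misses-L ⟩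
  m ∸ 1                                            ≡⟨ *-identityʳ (m ∸ 1) ⟨
  (m ∸ 1) * 1                                      ≤⟨ *-monoʳ-≤ (m ∸ 1) s₀-hits-nonEdge ⟩
  (m ∸ 1) * landing M (nonEdges G) v               ∎
  where
  open ≤-Reasoning
  m = length (edges M)
  s₀ = proj₁ (find some-edge-leaves-G)
  s₀∈M = proj₁ (proj₂ (find some-edge-leaves-G))
  v[s₀]∉G = proj₂ (proj₂ (find some-edge-leaves-G))
  s₀-misses-L : ∑ L (δ (image (lookup v) s₀)) ≡ 0
  s₀-misses-L = ∑-zero _ (All-map (λ (e∈G , _) → δ-≢ λ { refl → contradiction (trans (sym v[s₀]∉G) e∈G) λ () }) L⊆G₀)
  s₀-hits-nonEdge : 1 ≤ landing M (nonEdges G) v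
  s₀-hits-nonEdge = ≤-trans (≤-reflexive (sym (δ-refl (image (lookup v) s₀))))
    (≤-trans (∑-member (δ (image (lookup v) s₀))
               (∈-nonEdges⁺ G (trans (∣image∣ (lookup v) v-emb s₀) (uniform M s₀ (∈-edges⁻ M s₀∈M))) v[s₀]∉G))
             (∑-member (λ s → ∑ (nonEdges G) (δ (image (lookup v) s))) s₀∈M))
... | no no-edge-leaves-G = ≤-trans (≤-reflexive L-unhit) z≤n
  where
  v-copy : IsCopy M G (lookup v)
  v-copy = v-emb , λ s s∈M → ¬-not λ v[s]∉G → no-edge-leaves-G (lose (∈-edges⁺ M s∈M) v[s]∉G)
  L-unhit : landing M L v ≡ 0
  L-unhit = ∑-zero _ (All-tabulate λ {s} s∈M →
    ∑-zero _ (All-map (λ (_ , in-no-copy) → δ-≢ λ v[s]≡e → in-no-copy (lookup v , v-copy , s , ∈-edges⁻ M s∈M , v[s]≡e)) L⊆G₀))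

-- Lemma 9.1: sum the local bound over all embeddings; both sides count copies
-- through r-sets, each of which is passed through by the same K ≥ 1 copies.
lemma9p1 : (r k n : ℕ) (M : Graph r k) (G : Graph r n) →
    2 ≤ length (edges M) → k ≤ n →
    (L : List (Subset n)) → Unique L → All (InG₀ M G) L →
    length L ≤ (length (edges M) ∸ 1) * length (nonEdges G)
lemma9p1 r k n M G 2≤m k≤n L uL L⊆G₀ with r-set-with-copy M k≤n (≤-trans (s≤s z≤n) 2≤m)
... | e₀ , ∣e₀∣≡r , 1≤K = *-cancelʳ-≤ (length L) ((m ∸ 1) * length NE) K {{>-nonZero 1≤K}} (begin
  length L * K                        ≡⟨ ∑-copiesThrough-r-sets M ∣e₀∣≡r L L-r-sets ⟨
  ∑ L (copiesThrough M)               ≡⟨ ∑-copiesThrough M L ⟩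
  ∑ Emb (landing M L)                 ≤⟨ ∑-mono Emb (λ {v} v∈ → local-bound M G uL L⊆G₀ v (∈-embeddings⁻ v∈)) ⟩
  ∑ Emb (λ v → (m ∸ 1) * landing M NE v) ≡⟨ ∑-*ˡ Emb (m ∸ 1) (landing M NE) ⟩
  (m ∸ 1) * ∑ Emb (landing M NE)      ≡⟨ cong ((m ∸ 1) *_) (∑-copiesThrough M NE) ⟨
  (m ∸ 1) * ∑ NE (copiesThrough M)    ≡⟨ cong ((m ∸ 1) *_) (∑-copiesThrough-r-sets M ∣e₀∣≡r NE NE-r-sets) ⟩
  (m ∸ 1) * (length NE * K)           ≡⟨ *-assoc (m ∸ 1) (length NE) K ⟨
  (m ∸ 1) * length NE * K             ∎)
  where
  open ≤-Reasoning
  m = length (edges M)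
  NE = nonEdges G
  Emb = embeddings n k
  K = copiesThrough M e₀
  L-r-sets : ∀ {e} → e ∈ L → ∣ e ∣ ≡ r
  L-r-sets e∈L = uniform G _ (proj₁ (All-lookup L⊆G₀ e∈L))
  NE-r-sets : ∀ {e} → e ∈ NE → ∣ e ∣ ≡ r
  NE-r-sets e∈NE = proj₁ (∈-nonEdges⁻ G e∈NE)
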